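{- Let $X$ be an affine source over $\{0,1\}^n$ with entropy $n-r$, and write $X=X_1\circ\cdots\circ X_t$ where each block $X_i$ consists of $n_i$ bits, so $\sum_i n_i=n$. Then $X$ is a convex combination of affine sources $X^j$ such that, for each $j$, writing $X^j=X^j_1\circ\cdots\circ X^j_t$ with the same block lengths, the random variables $X^j_1,\dots,X^j_t$ are independent affine sources and each $X^j_i$ has entropy at least $n_i-r$.
   Context: An affine source over $\{0,1\}^n$ is the uniform distribution over an affine subspace of $\mathbb{F}_2^n$; its entropy is the dimension of that subspace. $\circ$ denotes concatenation of strings. -}

module Defs where

open import Data.Nat using (ℕ; zero; suc; _^_; _≤_; _∸_)
open import Data.Nat.Properties using (m^n≢0)
open import Data.Bool using (Bool; true; false; _xor_)
open import Data.Vec using (Vec; []; _∷_; zipWith; replicate; take; drop)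
import Data.Vec.Properties as VP
import Data.Bool.Properties as BP
open import Data.List using (List; []; _∷_; _++_; map; foldr; length; filter)
open import Data.Nat.ListAction using (sum)
open import Data.List.Relation.Unary.All using (All; []; _∷_)
open import Data.Integer using (+_)
open import Data.Rational using (ℚ; _/_; _*_; _+_; 0ℚ; 1ℚ)
open import Data.Unit using (⊤)
open import Data.Product using (_×_)
open import Relation.Binary.PropositionalEquality using (_≡_)
open import Relation.Nullary using (Dec)

BitVec : ℕ → Set
BitVec n = Vec Bool n

_⊕_ : ∀ {n} → BitVec n → BitVec n → BitVec n
_⊕_ = zipWith _xor_

zeroV : ∀ n → BitVec n
zeroV n = replicate n false

lincomb : ∀ {n k} → Vec (BitVec n) k → BitVec k → BitVec n
lincomb {n} []       []       = zeroV n
lincomb     (b ∷ bs) (true  ∷ c) = b ⊕ lincomb bs c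
lincomb     (b ∷ bs) (false ∷ c) = lincomb bs c

-- An affine source over {0,1}^n: the uniform distribution on the affine
-- subspace  shift + span(basis), with basis linearly independent over F_2.
record AffineSource (n : ℕ) : Set where
  field
    dim   : ℕ
    shift : BitVec n
    basis : Vec (BitVec n) dim
    indep : ∀ (c : BitVec dim) → lincomb basis c ≡ zeroV n → c ≡ zeroV dim

open AffineSource public

entropy : ∀ {n} → AffineSource n → ℕ
entropy = dim

allVecs : (k : ℕ) → List (BitVec k)
allVecs zero    = [] ∷ []
allVecs (suc k) = map (true ∷_) (allVecs k) ++ map (false ∷_) (allVecs k)

_≟V_ : ∀ {n} (x y : BitVec n) → Dec (x ≡ y)
_≟V_ = VP.≡-dec BP._≟_

-- Probability mass function of the affine source X at point x:
-- Pr[X = x] = #{ c ∈ F_2^dim : shift ⊕ Σ c_i b_i = x } / 2^dim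
-- (which, by linear independence, is 1/|S| on the subspace S and 0 off it).
pmf : ∀ {n} → AffineSource n → BitVec n → ℚ
pmf X x =
  _/_ (+ length (filter (λ c → (shift X ⊕ lincomb (basis X) c) ≟V x) (allVecs (dim X))))
      (2 ^ dim X) {{m^n≢0 2 (dim X)}}

sumℚ : List ℚ → ℚ
sumℚ = foldr _+_ 0ℚ

-- pmf of the concatenation Y₁ ∘ ⋯ ∘ Y_t of INDEPENDENT affine sources
-- Y_i over {0,1}^{n_i}: the product of the block pmfs.
prodPmf : ∀ (ns : List ℕ) → All AffineSource ns → BitVec (sum ns) → ℚ
prodPmf []       []       x = 1ℚ
prodPmf (m ∷ ns) (Y ∷ Ys) x = pmf Y (take m x) * prodPmf ns Ys (drop m x)

EntropyBounds : ℕ → ∀ (ns : List ℕ) → All AffineSource ns → Set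
EntropyBounds r []       []       = ⊤
EntropyBounds r (m ∷ ns) (Y ∷ Ys) = (m ∸ r ≤ entropy Y) × EntropyBounds r ns Ys

-- Write X = s + span B with B independent of size d ≥ n - r. Rank–nullity shows that span B meets
-- the vectors supported on the first block in dimension ≥ d - (n - n₁) ≥ n₁ - r, and the vectors
-- supported on the other blocks in dimension ≥ d - n₁ ≥ (n - n₁) - r; recursing into the latter
-- gives a block-diagonal subspace W = W₁ ⊕ ⋯ ⊕ W_t ⊆ span B with dim W_i ≥ n_i - r. Then X is
-- the uniform mixture, over c ∈ F₂^d, of the cosets s + Bc + W, and the uniform distribution on
-- a coset of a block-diagonal subspace is the product of the uniform distributions on its blocks.

module Submission where

open import Defs
open import Data.Nat as ℕ using (ℕ; zero; suc; _+_; _^_; _∸_; z≤n; s≤s; NonZero)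
open import Data.Nat.Properties
open import Data.Bool using (true; false; _xor_)
import Data.Bool.Properties as Boolₚ
open import Data.Vec using (Vec; []; _∷_; take; drop; _++_)
import Data.Vec as Vec
import Data.Vec.Properties as Vecₚ
open import Data.List using (List; []; _∷_; map; allFin; filter; length; lookup)
import Data.List as List
import Data.List.Properties as Listₚ
open import Data.Nat.ListAction using (sum)
import Data.Nat.ListAction.Properties as Sumₚ
open import Data.List.Relation.Unary.All using (All; []; _∷_)
open import Data.Unit using (tt)
open import Data.Fin using (Fin)
open import Data.Product using (Σ; Σ-syntax; _×_; _,_; proj₁; proj₂)
open import Data.Empty using (⊥-elim)
open import Function using (_∘_)
open import Data.Integer as ℤ using (+_)
import Data.Integer.Properties as ℤₚ
open import Data.Integer.Tactic.RingSolver using (solve-∀)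
open import Data.Rational using (ℚ; _≤_; _*_; _/_; 0ℚ; 1ℚ; toℚᵘ)
import Data.Rational as ℚ
import Data.Rational.Properties as ℚₚ
import Data.Rational.Unnormalised as ℚᵘ
import Data.Rational.Unnormalised.Properties as ℚᵘₚ
open import Algebra.Bundles using (AbelianGroup)
open import Algebra.Structures using (IsAbelianGroup)
open import Relation.Nullary using (Dec; yes; no; ¬_; _×-dec_)
open import Relation.Binary.PropositionalEquality
open ≡-Reasoning

⊕-isAbelianGroup : ∀ n → IsAbelianGroup _≡_ _⊕_ (zeroV n) (λ x → x)
⊕-isAbelianGroup n = record
  { isGroup = record
    { isMonoid = record
      { isSemigroup = record
        { isMagma = record { isEquivalence = isEquivalence ; ∙-cong = cong₂ _⊕_ }
        ; assoc = Vecₚ.zipWith-assoc Boolₚ.xor-assoc }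
      ; identity = Vecₚ.zipWith-identityˡ Boolₚ.xor-identityˡ , Vecₚ.zipWith-identityʳ Boolₚ.xor-identityʳ }
    ; inverse = self-inverse , self-inverse
    ; ⁻¹-cong = λ eq → eq }
  ; comm = Vecₚ.zipWith-comm Boolₚ.xor-comm }
  where
  self-inverse : ∀ {n} (x : BitVec n) → x ⊕ x ≡ zeroV n
  self-inverse []      = refl
  self-inverse (b ∷ x) = cong₂ _∷_ (Boolₚ.xor-same b) (self-inverse x)

⊕-abelianGroup : ℕ → AbelianGroup _ _
⊕-abelianGroup n = record { isAbelianGroup = ⊕-isAbelianGroup n }

module _ {n : ℕ} where
  open AbelianGroup (⊕-abelianGroup n) public
    using () renaming (assoc to ⊕-assoc; comm to ⊕-comm; identityˡ to ⊕-identityˡ;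
                       identityʳ to ⊕-identityʳ; inverseˡ to ⊕-self)
  open import Algebra.Properties.AbelianGroup (⊕-abelianGroup n) public
    using () renaming (inverseˡ-unique to ⊕≡zero⇒≡)
  open import Algebra.Properties.CommutativeSemigroup
    (AbelianGroup.commutativeSemigroup (⊕-abelianGroup n)) public
    using () renaming (interchange to ⊕-interchange)

Additive : ∀ {m n} → (BitVec m → BitVec n) → Set
Additive f = ∀ u v → f (u ⊕ v) ≡ f u ⊕ f v

additive⇒zero : ∀ {m n} {f : BitVec m → BitVec n} → Additive f → f (zeroV m) ≡ zeroV n
additive⇒zero {m} {f = f} f-add = begin
  f (zeroV m)               ≡⟨ cong f (sym (⊕-self (zeroV m))) ⟩
  f (zeroV m ⊕ zeroV m)     ≡⟨ f-add (zeroV m) (zeroV m) ⟩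
  f (zeroV m) ⊕ f (zeroV m) ≡⟨ ⊕-self (f (zeroV m)) ⟩
  zeroV _                   ∎

lincomb-additive : ∀ {n k} (B : Vec (BitVec n) k) → Additive (lincomb B)
lincomb-additive []      []          []          = sym (⊕-identityˡ (zeroV _))
lincomb-additive (b ∷ B) (true ∷ u)  (true ∷ v)  = begin
  lincomb B (u ⊕ v)                           ≡⟨ lincomb-additive B u v ⟩
  lincomb B u ⊕ lincomb B v                   ≡⟨ ⊕-identityˡ _ ⟨
  zeroV _ ⊕ (lincomb B u ⊕ lincomb B v)       ≡⟨ cong (_⊕ _) (⊕-self b) ⟨
  (b ⊕ b) ⊕ (lincomb B u ⊕ lincomb B v)       ≡⟨ ⊕-interchange b b _ _ ⟩
  (b ⊕ lincomb B u) ⊕ (b ⊕ lincomb B v)       ∎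
lincomb-additive (b ∷ B) (true ∷ u)  (false ∷ v) = begin
  b ⊕ lincomb B (u ⊕ v)                       ≡⟨ cong (b ⊕_) (lincomb-additive B u v) ⟩
  b ⊕ (lincomb B u ⊕ lincomb B v)             ≡⟨ ⊕-assoc b _ _ ⟨
  (b ⊕ lincomb B u) ⊕ lincomb B v             ∎
lincomb-additive (b ∷ B) (false ∷ u) (true ∷ v)  = begin
  b ⊕ lincomb B (u ⊕ v)                       ≡⟨ cong (b ⊕_) (lincomb-additive B u v) ⟩
  b ⊕ (lincomb B u ⊕ lincomb B v)             ≡⟨ ⊕-assoc b _ _ ⟨
  (b ⊕ lincomb B u) ⊕ lincomb B v             ≡⟨ cong (_⊕ lincomb B v) (⊕-comm b _) ⟩
  (lincomb B u ⊕ b) ⊕ lincomb B v             ≡⟨ ⊕-assoc _ b _ ⟩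
  lincomb B u ⊕ (b ⊕ lincomb B v)             ∎
lincomb-additive (b ∷ B) (false ∷ u) (false ∷ v) = lincomb-additive B u v

lincomb-map : ∀ {m n k} {f : BitVec m → BitVec n} → Additive f →
              (B : Vec (BitVec m) k) (c : BitVec k) →
              lincomb (Vec.map f B) c ≡ f (lincomb B c)
lincomb-map f-add []      []          = sym (additive⇒zero f-add)
lincomb-map f-add (b ∷ B) (true ∷ c)  =
  trans (cong (_ ⊕_) (lincomb-map f-add B c)) (sym (f-add b _))
lincomb-map f-add (b ∷ B) (false ∷ c) = lincomb-map f-add B c

lincomb-++ : ∀ {n i j} (B : Vec (BitVec n) i) (C : Vec (BitVec n) j) a b →
             lincomb (B ++ C) (a ++ b) ≡ lincomb B a ⊕ lincomb C b
lincomb-++ []      C []          b = sym (⊕-identityˡ _)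
lincomb-++ (x ∷ B) C (true ∷ a)  b = trans (cong (x ⊕_) (lincomb-++ B C a b)) (sym (⊕-assoc x _ _))
lincomb-++ (x ∷ B) C (false ∷ a) b = lincomb-++ B C a b

Independent : ∀ {n k} → Vec (BitVec n) k → Set
Independent {n} {k} B = ∀ c → lincomb B c ≡ zeroV n → c ≡ zeroV k

independent⇒lincomb-injective : ∀ {n k} (B : Vec (BitVec n) k) → Independent B →
                                ∀ a b → lincomb B a ≡ lincomb B b → a ≡ b
independent⇒lincomb-injective B B-indep a b eq = ⊕≡zero⇒≡ a b (B-indep (a ⊕ b) (begin
  lincomb B (a ⊕ b)         ≡⟨ lincomb-additive B a b ⟩
  lincomb B a ⊕ lincomb B b ≡⟨ cong (_⊕ lincomb B b) eq ⟩
  lincomb B b ⊕ lincomb B b ≡⟨ ⊕-self (lincomb B b) ⟩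
  zeroV _                   ∎))

InSpan : ∀ {n k} → Vec (BitVec n) k → BitVec n → Set
InSpan {k = k} B v = Σ[ c ∈ BitVec k ] lincomb B c ≡ v

record Basis (n : ℕ) : Set where
  field
    size        : ℕ
    vectors     : Vec (BitVec n) size
    independent : Independent vectors

open Basis

coset : ∀ {n} → BitVec n → Basis n → AffineSource n
coset y E = record { dim = size E ; shift = y ; basis = vectors E ; indep = independent E }

zeroV-++ : ∀ m n → zeroV m ++ zeroV n ≡ zeroV (m + n)
zeroV-++ zero    n = refl
zeroV-++ (suc m) n = cong (false ∷_) (zeroV-++ m n)

++-⊕ : ∀ {m n} (u u′ : BitVec m) (v v′ : BitVec n) → (u ++ v) ⊕ (u′ ++ v′) ≡ (u ⊕ u′) ++ (v ⊕ v′)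
++-⊕ u u′ v v′ = Vecₚ.zipWith-++ _xor_ u v u′ v′

padʳ-additive : ∀ {m} n → Additive (λ (u : BitVec m) → u ++ zeroV n)
padʳ-additive n u v = sym (trans (++-⊕ u v (zeroV n) (zeroV n)) (cong (_ ++_) (⊕-self (zeroV n))))

padˡ-additive : ∀ m {n} → Additive (λ (v : BitVec n) → zeroV m ++ v)
padˡ-additive m u v = sym (trans (++-⊕ (zeroV m) (zeroV m) u v) (cong (_++ _) (⊕-self (zeroV m))))

blockVectors : ∀ {m n i j} → Vec (BitVec m) i → Vec (BitVec n) j → Vec (BitVec (m + n)) (i + j)
blockVectors {m} {n} E F = Vec.map (_++ zeroV n) E ++ Vec.map (zeroV m ++_) F

pad-⊕ : ∀ {m n} (u : BitVec m) (v : BitVec n) → (u ++ zeroV n) ⊕ (zeroV m ++ v) ≡ u ++ v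
pad-⊕ {m} {n} u v = begin
  (u ++ zeroV n) ⊕ (zeroV m ++ v) ≡⟨ ++-⊕ u (zeroV m) (zeroV n) v ⟩
  (u ⊕ zeroV m) ++ (zeroV n ⊕ v) ≡⟨ cong₂ _++_ (⊕-identityʳ u) (⊕-identityˡ v) ⟩
  u ++ v                          ∎

lincomb-blockVectors : ∀ {m n i j} (E : Vec (BitVec m) i) (F : Vec (BitVec n) j) a b →
                       lincomb (blockVectors E F) (a ++ b) ≡ lincomb E a ++ lincomb F b
lincomb-blockVectors {m} {n} E F a b = begin
  lincomb (blockVectors E F) (a ++ b)
    ≡⟨ lincomb-++ (Vec.map (_++ zeroV n) E) (Vec.map (zeroV m ++_) F) a b ⟩
  lincomb (Vec.map (_++ zeroV n) E) a ⊕ lincomb (Vec.map (zeroV m ++_) F) b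
    ≡⟨ cong₂ _⊕_ (lincomb-map (padʳ-additive n) E a) (lincomb-map (padˡ-additive m) F b) ⟩
  (lincomb E a ++ zeroV n) ⊕ (zeroV m ++ lincomb F b)
    ≡⟨ pad-⊕ (lincomb E a) (lincomb F b) ⟩
  lincomb E a ++ lincomb F b ∎

lincomb-blockVectors-split : ∀ {m n i j} (E : Vec (BitVec m) i) (F : Vec (BitVec n) j) e →
                             lincomb (blockVectors E F) e ≡ lincomb E (take i e) ++ lincomb F (drop i e)
lincomb-blockVectors-split {i = i} E F e = begin
  lincomb (blockVectors E F) e                   ≡⟨ cong (lincomb (blockVectors E F)) (Vecₚ.take++drop≡id i e) ⟨
  lincomb (blockVectors E F) (take i e ++ drop i e) ≡⟨ lincomb-blockVectors E F _ _ ⟩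
  lincomb E (take i e) ++ lincomb F (drop i e)   ∎

_⊞_ : ∀ {m n} → Basis m → Basis n → Basis (m + n)
_⊞_ {m} {n} E F = record
  { size = size E + size F ; vectors = blockVectors (vectors E) (vectors F) ; independent = indep′ }
  where
  indep′ : Independent (blockVectors (vectors E) (vectors F))
  indep′ c eq = begin
    c                                  ≡⟨ Vecₚ.take++drop≡id (size E) c ⟨
    take (size E) c ++ drop (size E) c
      ≡⟨ cong₂ _++_ (independent E _ (proj₁ parts)) (independent F _ (proj₂ parts)) ⟩
    zeroV (size E) ++ zeroV (size F)   ≡⟨ zeroV-++ (size E) (size F) ⟩
    zeroV _                            ∎
    where
    parts : (lincomb (vectors E) (take (size E) c) ≡ zeroV m)
          × (lincomb (vectors F) (drop (size E) c) ≡ zeroV n)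
    parts = Vecₚ.++-injective _ (zeroV m)
      (trans (sym (lincomb-blockVectors-split (vectors E) (vectors F) c)) (trans eq (sym (zeroV-++ m n))))

-- Counting over F₂^k

∑ : ∀ k → (BitVec k → ℕ) → ℕ
∑ zero    f = f []
∑ (suc k) f = ∑ k (λ c → f (true ∷ c)) + ∑ k (λ c → f (false ∷ c))

𝟙 : ∀ {A : Set} → Dec A → ℕ
𝟙 (yes _) = 1
𝟙 (no _)  = 0

𝟙-cong : ∀ {A B : Set} → (A → B) → (B → A) → (a : Dec A) (b : Dec B) → 𝟙 a ≡ 𝟙 b
𝟙-cong f g (yes _) (yes _) = refl
𝟙-cong f g (yes a) (no ¬b) = ⊥-elim (¬b (f a))
𝟙-cong f g (no ¬a) (yes b) = ⊥-elim (¬a (g b))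
𝟙-cong f g (no _)  (no _)  = refl

length-filter : ∀ {A : Set} {P : A → Set} (P? : ∀ a → Dec (P a)) xs →
                length (filter P? xs) ≡ sum (map (𝟙 ∘ P?) xs)
length-filter P? []       = refl
length-filter P? (x ∷ xs) with P? x
... | yes _ = cong suc (length-filter P? xs)
... | no _  = length-filter P? xs

sum-allVecs : ∀ k (f : BitVec k → ℕ) → sum (map f (allVecs k)) ≡ ∑ k f
sum-allVecs zero    f = +-identityʳ (f [])
sum-allVecs (suc k) f = begin
  sum (map f (map (true ∷_) (allVecs k) List.++ map (false ∷_) (allVecs k)))
    ≡⟨ cong sum (Listₚ.map-++ f (map (true ∷_) (allVecs k)) _) ⟩
  sum (map f (map (true ∷_) (allVecs k)) List.++ map f (map (false ∷_) (allVecs k)))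
    ≡⟨ Sumₚ.sum-++ (map f (map (true ∷_) (allVecs k))) _ ⟩
  sum (map f (map (true ∷_) (allVecs k))) + sum (map f (map (false ∷_) (allVecs k)))
    ≡⟨ cong₂ _+_ (cong sum (Listₚ.map-∘ (allVecs k))) (cong sum (Listₚ.map-∘ (allVecs k))) ⟨
  sum (map (λ c → f (true ∷ c)) (allVecs k)) + sum (map (λ c → f (false ∷ c)) (allVecs k))
    ≡⟨ cong₂ _+_ (sum-allVecs k _) (sum-allVecs k _) ⟩
  ∑ (suc k) f ∎

∑-cong : ∀ k {f g : BitVec k → ℕ} → (∀ c → f c ≡ g c) → ∑ k f ≡ ∑ k g
∑-cong zero    f≗g = f≗g []
∑-cong (suc k) f≗g = cong₂ _+_ (∑-cong k (f≗g ∘ (true ∷_))) (∑-cong k (f≗g ∘ (false ∷_)))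

∑-mono : ∀ k {f g : BitVec k → ℕ} → (∀ c → f c ℕ.≤ g c) → ∑ k f ℕ.≤ ∑ k g
∑-mono zero    f≤g = f≤g []
∑-mono (suc k) f≤g = +-mono-≤ (∑-mono k (f≤g ∘ (true ∷_))) (∑-mono k (f≤g ∘ (false ∷_)))

∑-+ : ∀ k (f g : BitVec k → ℕ) → ∑ k (λ c → f c + g c) ≡ ∑ k f + ∑ k g
∑-+ zero    f g = refl
∑-+ (suc k) f g = trans (cong₂ _+_ (∑-+ k _ _) (∑-+ k _ _))
  (+-interchange (∑ k (f ∘ (true ∷_))) (∑ k (g ∘ (true ∷_))) (∑ k (f ∘ (false ∷_))) (∑ k (g ∘ (false ∷_))))
  where open import Algebra.Properties.CommutativeSemigroup +-commutativeSemigroup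
          using () renaming (interchange to +-interchange)

∑-*ʳ : ∀ k (f : BitVec k → ℕ) a → ∑ k (λ c → f c ℕ.* a) ≡ ∑ k f ℕ.* a
∑-*ʳ zero    f a = refl
∑-*ʳ (suc k) f a =
  trans (cong₂ _+_ (∑-*ʳ k _ a) (∑-*ʳ k _ a)) (sym (*-distribʳ-+ a (∑ k _) (∑ k _)))

∑-*ˡ : ∀ k (f : BitVec k → ℕ) a → ∑ k (λ c → a ℕ.* f c) ≡ a ℕ.* ∑ k f
∑-*ˡ k f a = begin
  ∑ k (λ c → a ℕ.* f c) ≡⟨ ∑-cong k (λ c → *-comm a (f c)) ⟩
  ∑ k (λ c → f c ℕ.* a) ≡⟨ ∑-*ʳ k f a ⟩
  ∑ k f ℕ.* a           ≡⟨ *-comm (∑ k f) a ⟩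
  a ℕ.* ∑ k f           ∎

∑-const : ∀ k a → ∑ k (λ _ → a) ≡ 2 ^ k ℕ.* a
∑-const zero    a = sym (+-identityʳ a)
∑-const (suc k) a = begin
  ∑ k (λ _ → a) + ∑ k (λ _ → a)   ≡⟨ cong₂ _+_ (∑-const k a) (∑-const k a) ⟩
  2 ^ k ℕ.* a + 2 ^ k ℕ.* a       ≡⟨ *-distribʳ-+ a (2 ^ k) (2 ^ k) ⟨
  (2 ^ k + 2 ^ k) ℕ.* a           ≡⟨ cong (λ t → (2 ^ k + t) ℕ.* a) (+-identityʳ (2 ^ k)) ⟨
  2 ^ suc k ℕ.* a                 ∎

∑-comm : ∀ k l (g : BitVec k → BitVec l → ℕ) →
         ∑ k (λ c → ∑ l (g c)) ≡ ∑ l (λ e → ∑ k (λ c → g c e))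
∑-comm zero    l g = refl
∑-comm (suc k) l g = trans (cong₂ _+_ (∑-comm k l _) (∑-comm k l _)) (sym (∑-+ l _ _))

∑-translate : ∀ k (f : BitVec k → ℕ) a → ∑ k (λ c → f (c ⊕ a)) ≡ ∑ k f
∑-translate zero    f []          = refl
∑-translate (suc k) f (true ∷ a)  =
  trans (cong₂ _+_ (∑-translate k _ a) (∑-translate k _ a)) (+-comm (∑ k _) (∑ k _))
∑-translate (suc k) f (false ∷ a) = cong₂ _+_ (∑-translate k _ a) (∑-translate k _ a)

∑-++ : ∀ k l (f : BitVec (k + l) → ℕ) → ∑ (k + l) f ≡ ∑ k (λ a → ∑ l (λ b → f (a ++ b)))
∑-++ zero    l f = refl
∑-++ (suc k) l f = cong₂ _+_ (∑-++ k l _) (∑-++ k l _)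

∑-zero : ∀ k {f : BitVec k → ℕ} → (∀ c → f c ≡ 0) → ∑ k f ≡ 0
∑-zero zero    f≡0 = f≡0 []
∑-zero (suc k) f≡0 = cong₂ _+_ (∑-zero k (f≡0 ∘ (true ∷_))) (∑-zero k (f≡0 ∘ (false ∷_)))

𝟙-no : ∀ {A : Set} → ¬ A → (a : Dec A) → 𝟙 a ≡ 0
𝟙-no ¬a (yes a) = ⊥-elim (¬a a)
𝟙-no ¬a (no _)  = refl

∑-point : ∀ k (z : BitVec k) → ∑ k (λ y → 𝟙 (z ≟V y)) ≡ 1
∑-point zero    []          = refl
∑-point (suc k) (true ∷ z)  = cong₂ _+_
  (trans (∑-cong k (λ y → 𝟙-cong Vecₚ.∷-injectiveʳ (cong (true ∷_)) ((true ∷ z) ≟V (true ∷ y)) (z ≟V y)))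
         (∑-point k z))
  (∑-zero k (λ y → 𝟙-no (λ ()) ((true ∷ z) ≟V (false ∷ y))))
∑-point (suc k) (false ∷ z) = cong₂ _+_
  (∑-zero k (λ y → 𝟙-no (λ ()) ((false ∷ z) ≟V (true ∷ y))))
  (trans (∑-cong k (λ y → 𝟙-cong Vecₚ.∷-injectiveʳ (cong (false ∷_)) ((false ∷ z) ≟V (false ∷ y)) (z ≟V y)))
         (∑-point k z))

any? : ∀ k {P : BitVec k → Set} → (∀ c → Dec (P c)) → Dec (Σ (BitVec k) P)
any? zero P? with P? []
... | yes p = yes ([] , p)
... | no ¬p = no λ { ([] , p) → ¬p p }
any? (suc k) P? with any? k (P? ∘ (true ∷_)) | any? k (P? ∘ (false ∷_))
... | yes (c , p) | _           = yes (true ∷ c , p)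
... | no _        | yes (c , p) = yes (false ∷ c , p)
... | no ¬t       | no ¬f       = no λ { (true ∷ c , p) → ¬t (c , p) ; (false ∷ c , p) → ¬f (c , p) }

∑-unique : ∀ k {P : BitVec k → Set} (P? : ∀ c → Dec (P c)) →
           (∀ a b → P a → P b → a ≡ b) → ∑ k (𝟙 ∘ P?) ℕ.≤ 1
∑-unique k P? unique with any? k P?
... | yes (a , pa) = ≤-reflexive (trans
      (∑-cong k (λ c → 𝟙-cong (unique a c pa) (λ { refl → pa }) (P? c) (a ≟V c)))
      (∑-point k a))
... | no ∄ = ≤-trans (≤-reflexive (∑-zero k (λ c → 𝟙-no (λ pc → ∄ (c , pc)) (P? c)))) z≤n

injective⇒≤ : ∀ {i k} (f : BitVec i → BitVec k) → (∀ a b → f a ≡ f b → a ≡ b) → i ℕ.≤ k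
injective⇒≤ {i} {k} f f-inj = ≮⇒≥ (λ k<i → <⇒≱ (^-monoʳ-< 2 (s≤s (s≤s z≤n)) k<i) 2^i≤2^k)
  where
  fibres : ∑ k (λ y → ∑ i (λ c → 𝟙 (f c ≟V y))) ≡ 2 ^ i
  fibres = begin
    ∑ k (λ y → ∑ i (λ c → 𝟙 (f c ≟V y))) ≡⟨ ∑-comm i k (λ c y → 𝟙 (f c ≟V y)) ⟨
    ∑ i (λ c → ∑ k (λ y → 𝟙 (f c ≟V y))) ≡⟨ ∑-cong i (λ c → ∑-point k (f c)) ⟩
    ∑ i (λ _ → 1)                         ≡⟨ ∑-const i 1 ⟩
    2 ^ i ℕ.* 1                           ≡⟨ *-identityʳ (2 ^ i) ⟩
    2 ^ i                                 ∎
  2^i≤2^k : 2 ^ i ℕ.≤ 2 ^ k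
  2^i≤2^k = subst₂ ℕ._≤_ fibres (trans (∑-const k 1) (*-identityʳ (2 ^ k)))
    (∑-mono k (λ y → ∑-unique i (λ c → f c ≟V y) (λ a b fa≡y fb≡y → f-inj a b (trans fa≡y (sym fb≡y)))))

independent⇒≤ : ∀ {n k} (B : Vec (BitVec n) k) → Independent B → k ℕ.≤ n
independent⇒≤ B B-indep = injective⇒≤ (lincomb B) (independent⇒lincomb-injective B B-indep)

-- Rank–nullity

emptyBasis : ∀ {n} → Basis n
emptyBasis = record { size = 0 ; vectors = [] ; independent = λ { [] _ → refl } }

inSpan? : ∀ {n k} (B : Vec (BitVec n) k) v → Dec (InSpan B v)
inSpan? B v = any? _ (λ c → lincomb B c ≟V v)

lincomb-false∷ : ∀ {n k} (Z : Vec (BitVec n) k) c →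
                 lincomb (Vec.map (false ∷_) Z) c ≡ false ∷ lincomb Z c
lincomb-false∷ = lincomb-map (λ _ _ → refl)

record RankNullity {k d} (M : Vec (BitVec k) d) : Set where
  field
    kernel       : Basis d
    kernel-⊆     : ∀ a → lincomb M (lincomb (vectors kernel) a) ≡ zeroV k
    image        : Basis k
    image-⊆      : ∀ a → InSpan (vectors image) (lincomb M a)
    image-⊇      : ∀ b → InSpan M (lincomb (vectors image) b)
    rank-nullity : size kernel + size image ≡ d

module _ {k d} {M : Vec (BitVec k) d} (R : RankNullity M) (v : BitVec k) where
  open RankNullity R

  private
    Z = vectors kernel
    I = vectors image

  extend-dependent : InSpan M v → RankNullity (v ∷ M)
  extend-dependent (a₀ , Ma₀≡v) = record
    { kernel       = record { size = suc (size kernel) ; vectors = z₀ ∷ Vec.map (false ∷_) Z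
                            ; independent = indep′ }
    ; kernel-⊆     = kernel-⊆′
    ; image        = image
    ; image-⊆      = image-⊆′
    ; image-⊇      = λ b → let (a , Ma≡Ib) = image-⊇ b in false ∷ a , Ma≡Ib
    ; rank-nullity = cong suc rank-nullity }
    where
    z₀ : BitVec (suc d)
    z₀ = true ∷ a₀

    indep′ : Independent (z₀ ∷ Vec.map (false ∷_) Z)
    indep′ (true ∷ e)  eq with () ← trans (sym (cong (z₀ ⊕_) (lincomb-false∷ Z e))) eq
    indep′ (false ∷ e) eq =
      cong (false ∷_) (independent kernel e (Vecₚ.∷-injectiveʳ (trans (sym (lincomb-false∷ Z e)) eq)))

    kernel-⊆′ : ∀ e → lincomb (v ∷ M) (lincomb (z₀ ∷ Vec.map (false ∷_) Z) e) ≡ zeroV k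
    kernel-⊆′ (true ∷ e) rewrite lincomb-false∷ Z e = begin
      v ⊕ lincomb M (a₀ ⊕ lincomb Z e)              ≡⟨ cong (v ⊕_) (lincomb-additive M a₀ _) ⟩
      v ⊕ (lincomb M a₀ ⊕ lincomb M (lincomb Z e))  ≡⟨ cong₂ (λ s t → v ⊕ (s ⊕ t)) Ma₀≡v (kernel-⊆ e) ⟩
      v ⊕ (v ⊕ zeroV k)                             ≡⟨ cong (v ⊕_) (⊕-identityʳ v) ⟩
      v ⊕ v                                         ≡⟨ ⊕-self v ⟩
      zeroV k                                       ∎
    kernel-⊆′ (false ∷ e) rewrite lincomb-false∷ Z e = kernel-⊆ e

    image-⊆′ : ∀ a → InSpan I (lincomb (v ∷ M) a)
    image-⊆′ (false ∷ a) = image-⊆ a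
    image-⊆′ (true ∷ a)  =
      let (b₀ , Ib₀≡Ma₀) = image-⊆ a₀ ; (b , Ib≡Ma) = image-⊆ a in
      b₀ ⊕ b , (begin
        lincomb I (b₀ ⊕ b)         ≡⟨ lincomb-additive I b₀ b ⟩
        lincomb I b₀ ⊕ lincomb I b ≡⟨ cong₂ _⊕_ (trans Ib₀≡Ma₀ Ma₀≡v) Ib≡Ma ⟩
        v ⊕ lincomb M a            ∎)

  extend-independent : ¬ InSpan I v → RankNullity (v ∷ M)
  extend-independent v∉I = record
    { kernel       = record { size = size kernel ; vectors = Vec.map (false ∷_) Z ; independent = indep′ }
    ; kernel-⊆     = λ e → subst (λ x → lincomb (v ∷ M) x ≡ zeroV k) (sym (lincomb-false∷ Z e)) (kernel-⊆ e)
    ; image        = record { size = suc (size image) ; vectors = v ∷ I ; independent = indepI′ }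
    ; image-⊆      = image-⊆′
    ; image-⊇      = image-⊇′
    ; rank-nullity = trans (+-suc (size kernel) (size image)) (cong suc rank-nullity) }
    where
    indep′ : Independent (Vec.map (false ∷_) Z)
    indep′ e eq = independent kernel e (Vecₚ.∷-injectiveʳ (trans (sym (lincomb-false∷ Z e)) eq))

    indepI′ : Independent (v ∷ I)
    indepI′ (true ∷ b)  eq = ⊥-elim (v∉I (b , sym (⊕≡zero⇒≡ v _ eq)))
    indepI′ (false ∷ b) eq = cong (false ∷_) (independent image b eq)

    image-⊆′ : ∀ a → InSpan (v ∷ I) (lincomb (v ∷ M) a)
    image-⊆′ (true ∷ a)  = let (b , Ib≡Ma) = image-⊆ a in true ∷ b , cong (v ⊕_) Ib≡Ma
    image-⊆′ (false ∷ a) = let (b , Ib≡Ma) = image-⊆ a in false ∷ b , Ib≡Ma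

    image-⊇′ : ∀ b → InSpan (v ∷ M) (lincomb (v ∷ I) b)
    image-⊇′ (true ∷ b)  = let (a , Ma≡Ib) = image-⊇ b in true ∷ a , cong (v ⊕_) Ma≡Ib
    image-⊇′ (false ∷ b) = let (a , Ma≡Ib) = image-⊇ b in false ∷ a , Ma≡Ib

rankNullity : ∀ {k d} (M : Vec (BitVec k) d) → RankNullity M
rankNullity []      = record
  { kernel = emptyBasis ; kernel-⊆ = λ { [] → refl } ; image = emptyBasis
  ; image-⊆ = λ { [] → [] , refl } ; image-⊇ = λ { [] → [] , refl } ; rank-nullity = refl }
rankNullity (v ∷ M) with R ← rankNullity M | inSpan? (vectors (RankNullity.image R)) v
... | yes (b , Ib≡v) = let (a , Ma≡Ib) = RankNullity.image-⊇ R b in extend-dependent R v (a , trans Ma≡Ib Ib≡v)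
... | no v∉I         = extend-independent R v v∉I

nullity-≥ : ∀ {k d} (M : Vec (BitVec k) d) → d ℕ.≤ size (RankNullity.kernel (rankNullity M)) + k
nullity-≥ M = subst (ℕ._≤ size kernel + _) rank-nullity
                (+-monoʳ-≤ (size kernel) (independent⇒≤ (vectors image) (independent image)))
  where open RankNullity (rankNullity M)

-- The hypotheses make ι an isomorphism of F₂^m onto ker κ, with inverse π;
-- E is a basis of span B ∩ ker κ transported to F₂^m.
span∩ker-basis : ∀ {N m k d} (π : BitVec N → BitVec m) (κ : BitVec N → BitVec k) (ι : BitVec m → BitVec N) →
                 Additive π → Additive κ → Additive ι → (∀ v → κ v ≡ zeroV k → ι (π v) ≡ v) →
                 (B : Vec (BitVec N) d) → Independent B →
                 Σ[ E ∈ Basis m ] (d ℕ.≤ size E + k) × (∀ a → InSpan B (ι (lincomb (vectors E) a)))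
span∩ker-basis {k = k} π κ ι π-add κ-add ι-add ι∘π≡id B B-indep =
  record { size = size kernel ; vectors = E ; independent = E-indep } , nullity-≥ (Vec.map κ B) ,
  λ a → lincomb Z a , sym (ι-lincomb a)
  where
  open RankNullity (rankNullity (Vec.map κ B))
  Z = vectors kernel
  E = Vec.map π (Vec.map (lincomb B) Z)

  lincomb-E : ∀ a → lincomb E a ≡ π (lincomb B (lincomb Z a))
  lincomb-E a = trans (lincomb-map π-add (Vec.map (lincomb B) Z) a)
                      (cong π (lincomb-map (lincomb-additive B) Z a))

  ι-lincomb : ∀ a → ι (lincomb E a) ≡ lincomb B (lincomb Z a)
  ι-lincomb a = trans (cong ι (lincomb-E a)) (ι∘π≡id _ (begin
    κ (lincomb B (lincomb Z a))       ≡⟨ lincomb-map κ-add B (lincomb Z a) ⟨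
    lincomb (Vec.map κ B) (lincomb Z a) ≡⟨ kernel-⊆ a ⟩
    zeroV k                           ∎))

  E-indep : Independent E
  E-indep a Ea≡0 = independent kernel a (B-indep (lincomb Z a) (begin
    lincomb B (lincomb Z a) ≡⟨ ι-lincomb a ⟨
    ι (lincomb E a)         ≡⟨ cong ι Ea≡0 ⟩
    ι (zeroV _)             ≡⟨ additive⇒zero ι-add ⟩
    zeroV _                 ∎))

-- Block decomposition of a subspace

inSpan-⊕ : ∀ {n k} (B : Vec (BitVec n) k) {u v} → InSpan B u → InSpan B v → InSpan B (u ⊕ v)
inSpan-⊕ B (a , Ba≡u) (b , Bb≡v) = a ⊕ b , trans (lincomb-additive B a b) (cong₂ _⊕_ Ba≡u Bb≡v)

take-additive : ∀ m {n} → Additive (take m {n})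
take-additive m = Vecₚ.take-zipWith _xor_

drop-additive : ∀ m {n} → Additive (drop m {n})
drop-additive m = Vecₚ.drop-zipWith _xor_

blockDiag : ∀ {ns} → All Basis ns → Basis (sum ns)
blockDiag []       = emptyBasis
blockDiag (E ∷ Es) = E ⊞ blockDiag Es

blockCosets : ∀ ns → BitVec (sum ns) → All Basis ns → All AffineSource ns
blockCosets []       y []       = []
blockCosets (m ∷ ns) y (E ∷ Es) = coset (take m y) E ∷ blockCosets ns (drop m y) Es

cancel-bound : ∀ a b d e r → a + b ℕ.≤ d + r → d ℕ.≤ e + b → a ℕ.≤ e + r
cancel-bound a b d e r a+b≤d+r d≤e+b = +-cancelʳ-≤ b a (e + r)
  (≤-trans a+b≤d+r (≤-trans (+-monoˡ-≤ r d≤e+b) (≤-reflexive (xy∙z≈xz∙y e b r))))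
  where open import Algebra.Properties.CommutativeSemigroup +-commutativeSemigroup using (xy∙z≈xz∙y)

record BlockDecomposition ns (r : ℕ) {d} (B : Vec (BitVec (sum ns)) d) : Set where
  field
    blocks        : All Basis ns
    blocks-large  : ∀ y → EntropyBounds r ns (blockCosets ns y blocks)
    blockDiag-⊆   : ∀ e → InSpan B (lincomb (vectors (blockDiag blocks)) e)

blockDecompose : ∀ ns r {d} (B : Vec (BitVec (sum ns)) d) → Independent B → sum ns ℕ.≤ d + r →
                 BlockDecomposition ns r B
blockDecompose []       r B B-indep _ = record
  { blocks = [] ; blocks-large = λ _ → tt ; blockDiag-⊆ = λ { [] → zeroV _ , additive⇒zero (lincomb-additive B) } }
blockDecompose (m ∷ ns) r {d} B B-indep m+n≤d+r
  with E , d≤E+n , E⊆B ← span∩ker-basis (take m) (drop m) (_++ zeroV (sum ns))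
         (take-additive m) (drop-additive m) (padʳ-additive (sum ns))
         (λ v drop≡0 → trans (cong (take m v ++_) (sym drop≡0)) (Vecₚ.take++drop≡id m v)) B B-indep
     | B′ , d≤B′+m , B′⊆B ← span∩ker-basis (drop m) (take m) (zeroV m ++_)
         (drop-additive m) (take-additive m) (padˡ-additive m)
         (λ v take≡0 → trans (cong (_++ drop m v) (sym take≡0)) (Vecₚ.take++drop≡id m v)) B B-indep
  = record
  { blocks       = E ∷ blocks
  ; blocks-large = λ y → m∸r≤E , blocks-large (drop m y)
  ; blockDiag-⊆  = blockDiag-⊆′ }
  where
  n = sum ns

  m∸r≤E : m ∸ r ℕ.≤ size E
  m∸r≤E = m≤n+o⇒m∸n≤o m r (subst (m ℕ.≤_) (+-comm (size E) r) (cancel-bound m n d (size E) r m+n≤d+r d≤E+n))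

  n≤B′+r : n ℕ.≤ size B′ + r
  n≤B′+r = cancel-bound n m d (size B′) r (subst (ℕ._≤ d + r) (+-comm m n) m+n≤d+r) d≤B′+m

  open BlockDecomposition (blockDecompose ns r (vectors B′) (independent B′) n≤B′+r)

  blockDiag-⊆′ : ∀ e → InSpan B (lincomb (vectors (blockDiag (E ∷ blocks))) e)
  blockDiag-⊆′ e = subst (InSpan B) (trans (pad-⊕ u v) (sym (lincomb-blockVectors-split (vectors E) _ e)))
    (inSpan-⊕ B (E⊆B (take (size E) e))
      (let (c , B′c≡v) = blockDiag-⊆ (drop (size E) e) in subst (InSpan B) (cong (zeroV m ++_) B′c≡v) (B′⊆B c)))
    where
    u = lincomb (vectors E) (take (size E) e)
    v = lincomb (vectors (blockDiag blocks)) (drop (size E) e)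

dyadic : ℕ → ℕ → ℚ
dyadic a p = (+ a / 2 ^ p) {{m^n≢0 2 p}}

private
  toℚᵘ-/ : ∀ a d .{{_ : NonZero d}} → toℚᵘ (+ a / d) ℚᵘ.≃ (+ a ℚᵘ./ d)
  toℚᵘ-/ a (suc d) = ℚₚ.toℚᵘ-fromℚᵘ (ℚᵘ.mkℚᵘ (+ a) d)

  /-* : ∀ a b m n .{{_ : NonZero m}} .{{_ : NonZero n}} →
        (+ a / m) * (+ b / n) ≡ (+ (a ℕ.* b) / (m ℕ.* n)) {{m*n≢0 m n}}
  /-* a b m@(suc _) n@(suc _) = ℚₚ.toℚᵘ-injective (ℚᵘₚ.≃-trans
    (ℚₚ.toℚᵘ-homo-* (+ a / m) (+ b / n))
    (ℚᵘₚ.≃-trans (ℚᵘₚ.*-cong (toℚᵘ-/ a m) (toℚᵘ-/ b n)) (ℚᵘₚ.≃-trans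
      (ℚᵘₚ.≃-reflexive (cong (ℚᵘ._/ (m ℕ.* n)) (sym (ℤₚ.pos-* a b))))
      (ℚᵘₚ.≃-sym (toℚᵘ-/ (a ℕ.* b) (m ℕ.* n))))))

  /-+ : ∀ a b d .{{_ : NonZero d}} → (+ a / d) ℚ.+ (+ b / d) ≡ + (a + b) / d
  /-+ a b d@(suc _) = ℚₚ.toℚᵘ-injective (ℚᵘₚ.≃-trans
    (ℚₚ.toℚᵘ-homo-+ (+ a / d) (+ b / d))
    (ℚᵘₚ.≃-trans (ℚᵘₚ.+-cong (toℚᵘ-/ a d) (toℚᵘ-/ b d)) (ℚᵘₚ.≃-trans
      (ℚᵘ.*≡* (cross-multiplied (+ a) (+ b) (+ d)))
      (ℚᵘₚ.≃-sym (toℚᵘ-/ (a + b) d)))))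
    where
    cross-multiplied : ∀ x y z → (x ℤ.* z ℤ.+ y ℤ.* z) ℤ.* z ≡ (x ℤ.+ y) ℤ.* (z ℤ.* z)
    cross-multiplied = solve-∀

  n/n≡1 : ∀ d .{{_ : NonZero d}} → + d / d ≡ 1ℚ
  n/n≡1 d@(suc _) = ℚₚ.toℚᵘ-injective (ℚᵘₚ.≃-trans (toℚᵘ-/ d d) (ℚᵘ.*≡* (ℤₚ.*-comm (+ d) (+ 1))))

dyadic-* : ∀ a b p q → dyadic a p * dyadic b q ≡ dyadic (a ℕ.* b) (p + q)
dyadic-* a b p q = trans (/-* a b (2 ^ p) (2 ^ q) {{m^n≢0 2 p}} {{m^n≢0 2 q}})
  (ℚₚ./-cong {+ (a ℕ.* b)} {{m*n≢0 (2 ^ p) (2 ^ q) {{m^n≢0 2 p}} {{m^n≢0 2 q}}}} {{m^n≢0 2 (p + q)}}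
    refl (sym (^-distribˡ-+-* 2 p q)))

dyadic-+ : ∀ a b p → dyadic a p ℚ.+ dyadic b p ≡ dyadic (a + b) p
dyadic-+ a b p = /-+ a b (2 ^ p) {{m^n≢0 2 p}}

dyadic-cancel : ∀ a p q → dyadic (2 ^ q ℕ.* a) (q + p) ≡ dyadic a p
dyadic-cancel a p q = begin
  dyadic (2 ^ q ℕ.* a) (q + p)   ≡⟨ dyadic-* (2 ^ q) a q p ⟨
  dyadic (2 ^ q) q * dyadic a p  ≡⟨ cong (_* dyadic a p) (n/n≡1 (2 ^ q) {{m^n≢0 2 q}}) ⟩
  1ℚ * dyadic a p                ≡⟨ ℚₚ.*-identityˡ (dyadic a p) ⟩
  dyadic a p                     ∎

dyadic-nonNeg : ∀ a p → 0ℚ ≤ dyadic a p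
dyadic-nonNeg a p = ℚₚ.nonNegative⁻¹ (dyadic a p) {{ℚₚ.normalize-nonNeg a (2 ^ p) {{m^n≢0 2 p}}}}

sumℚ-dyadic : ∀ {A : Set} p (f : A → ℕ) xs →
              sumℚ (map (λ x → dyadic (f x) p) xs) ≡ dyadic (sum (map f xs)) p
sumℚ-dyadic p f []       = sym (ℚₚ.0/n≡0 (2 ^ p) {{m^n≢0 2 p}})
sumℚ-dyadic p f (x ∷ xs) = trans (cong (dyadic (f x) p ℚ.+_) (sumℚ-dyadic p f xs)) (dyadic-+ (f x) _ p)

-- Distributions of affine sources

hits : ∀ {n D} → BitVec n → Vec (BitVec n) D → BitVec n → ℕ
hits {D = D} y E x = ∑ D (λ c → 𝟙 ((y ⊕ lincomb E c) ≟V x))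

pmf≡dyadic-hits : ∀ {n} (X : AffineSource n) x → pmf X x ≡ dyadic (hits (shift X) (basis X) x) (dim X)
pmf≡dyadic-hits X x = cong (λ h → dyadic h (dim X))
  (trans (length-filter (λ c → (shift X ⊕ lincomb (basis X) c) ≟V x) (allVecs (dim X))) (sum-allVecs (dim X) _))

𝟙-× : ∀ {A B : Set} (a : Dec A) (b : Dec B) → 𝟙 (a ×-dec b) ≡ 𝟙 a ℕ.* 𝟙 b
𝟙-× (yes _) (yes _) = refl
𝟙-× (yes _) (no _)  = refl
𝟙-× (no _)  _       = refl

𝟙-++ : ∀ {m n} (u u′ : BitVec m) (v v′ : BitVec n) →
       𝟙 ((u ++ v) ≟V (u′ ++ v′)) ≡ 𝟙 (u ≟V u′) ℕ.* 𝟙 (v ≟V v′)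
𝟙-++ u u′ v v′ = trans (𝟙-cong (Vecₚ.++-injective u u′) (λ (u≡u′ , v≡v′) → cong₂ _++_ u≡u′ v≡v′) _ _)
                       (𝟙-× (u ≟V u′) (v ≟V v′))

hits-blockVectors : ∀ {m n i j} (E : Vec (BitVec m) i) (F : Vec (BitVec n) j) y₁ y₂ x₁ x₂ →
                    hits (y₁ ++ y₂) (blockVectors E F) (x₁ ++ x₂) ≡ hits y₁ E x₁ ℕ.* hits y₂ F x₂
hits-blockVectors {i = i} {j} E F y₁ y₂ x₁ x₂ = begin
  ∑ (i + j) (λ c → 𝟙 (((y₁ ++ y₂) ⊕ lincomb (blockVectors E F) c) ≟V (x₁ ++ x₂)))
    ≡⟨ ∑-++ i j _ ⟩
  ∑ i (λ a → ∑ j (λ b → 𝟙 (((y₁ ++ y₂) ⊕ lincomb (blockVectors E F) (a ++ b)) ≟V (x₁ ++ x₂))))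
    ≡⟨ ∑-cong i (λ a → ∑-cong j (λ b → factor a b)) ⟩
  ∑ i (λ a → ∑ j (λ b → g a ℕ.* h b)) ≡⟨ ∑-cong i (λ a → ∑-*ˡ j h (g a)) ⟩
  ∑ i (λ a → g a ℕ.* ∑ j h)           ≡⟨ ∑-*ʳ i g (∑ j h) ⟩
  ∑ i g ℕ.* ∑ j h                     ∎
  where
  g = λ a → 𝟙 ((y₁ ⊕ lincomb E a) ≟V x₁)
  h = λ b → 𝟙 ((y₂ ⊕ lincomb F b) ≟V x₂)
  factor : ∀ a b → 𝟙 (((y₁ ++ y₂) ⊕ lincomb (blockVectors E F) (a ++ b)) ≟V (x₁ ++ x₂)) ≡ g a ℕ.* h b
  factor a b rewrite lincomb-blockVectors E F a b | ++-⊕ y₁ (lincomb E a) y₂ (lincomb F b) =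
    𝟙-++ (y₁ ⊕ lincomb E a) x₁ (y₂ ⊕ lincomb F b) x₂

pmf-⊞ : ∀ {m n} (E : Basis m) (F : Basis n) y x →
        pmf (coset y (E ⊞ F)) x ≡ pmf (coset (take m y) E) (take m x) * pmf (coset (drop m y) F) (drop m x)
pmf-⊞ {m} E F y x = begin
  pmf (coset y (E ⊞ F)) x
    ≡⟨ pmf≡dyadic-hits (coset y (E ⊞ F)) x ⟩
  dyadic (hits y (blockVectors (vectors E) (vectors F)) x) (size E + size F)
    ≡⟨ cong₂ (λ y x → dyadic (hits y (blockVectors (vectors E) (vectors F)) x) (size E + size F))
             (Vecₚ.take++drop≡id m y) (Vecₚ.take++drop≡id m x) ⟨
  dyadic (hits (take m y ++ drop m y) (blockVectors (vectors E) (vectors F)) (take m x ++ drop m x))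
         (size E + size F)
    ≡⟨ cong (λ h → dyadic h (size E + size F)) (hits-blockVectors (vectors E) (vectors F) _ _ _ _) ⟩
  dyadic (hits (take m y) (vectors E) (take m x) ℕ.* hits (drop m y) (vectors F) (drop m x))
         (size E + size F)
    ≡⟨ dyadic-* (hits (take m y) (vectors E) (take m x)) (hits (drop m y) (vectors F) (drop m x))
                (size E) (size F) ⟨
  dyadic (hits (take m y) (vectors E) (take m x)) (size E) * dyadic (hits (drop m y) (vectors F) (drop m x)) (size F)
    ≡⟨ cong₂ _*_ (pmf≡dyadic-hits (coset (take m y) E) (take m x))
                 (pmf≡dyadic-hits (coset (drop m y) F) (drop m x)) ⟨
  pmf (coset (take m y) E) (take m x) * pmf (coset (drop m y) F) (drop m x) ∎

pmf-blockDiag : ∀ ns y (Es : All Basis ns) x → pmf (coset y (blockDiag Es)) x ≡ prodPmf ns (blockCosets ns y Es) x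
pmf-blockDiag []       []  []       []  = refl
pmf-blockDiag (m ∷ ns) y   (E ∷ Es) x   = trans (pmf-⊞ E (blockDiag Es) y x)
  (cong (pmf (coset (take m y) E) (take m x) *_) (pmf-blockDiag ns (drop m y) Es (drop m x)))

module _ {n} (X : AffineSource n) (W : Basis n) (W⊆X : ∀ e → InSpan (basis X) (lincomb (vectors W) e)) where
  private
    d = dim X
    s = shift X
    B = basis X

  hits-cosets : ∀ x → ∑ d (λ c → hits (s ⊕ lincomb B c) (vectors W) x) ≡ 2 ^ size W ℕ.* hits s B x
  hits-cosets x = begin
    ∑ d (λ c → ∑ (size W) (λ e → 𝟙 (((s ⊕ lincomb B c) ⊕ lincomb (vectors W) e) ≟V x)))
      ≡⟨ ∑-comm d (size W) _ ⟩
    ∑ (size W) (λ e → ∑ d (λ c → 𝟙 (((s ⊕ lincomb B c) ⊕ lincomb (vectors W) e) ≟V x)))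
      ≡⟨ ∑-cong (size W) translate ⟩
    ∑ (size W) (λ _ → hits s B x)
      ≡⟨ ∑-const (size W) (hits s B x) ⟩
    2 ^ size W ℕ.* hits s B x ∎
    where
    translate : ∀ e → ∑ d (λ c → 𝟙 (((s ⊕ lincomb B c) ⊕ lincomb (vectors W) e) ≟V x)) ≡ hits s B x
    translate e = let (cₑ , Bcₑ≡We) = W⊆X e in
      trans (∑-cong d (λ c → cong (λ v → 𝟙 (v ≟V x)) (begin
        (s ⊕ lincomb B c) ⊕ lincomb (vectors W) e ≡⟨ cong ((s ⊕ lincomb B c) ⊕_) Bcₑ≡We ⟨
        (s ⊕ lincomb B c) ⊕ lincomb B cₑ          ≡⟨ ⊕-assoc s _ _ ⟩
        s ⊕ (lincomb B c ⊕ lincomb B cₑ)          ≡⟨ cong (s ⊕_) (lincomb-additive B c cₑ) ⟨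
        s ⊕ lincomb B (c ⊕ cₑ)                    ∎)))
        (∑-translate d (λ c → 𝟙 ((s ⊕ lincomb B c) ≟V x)) cₑ)

  pmf-average-cosets : ∀ x → pmf X x
                         ≡ sumℚ (map (λ c → dyadic 1 d * pmf (coset (s ⊕ lincomb B c) W) x) (allVecs d))
  pmf-average-cosets x = sym (begin
    sumℚ (map (λ c → dyadic 1 d * pmf (coset (s ⊕ lincomb B c) W) x) (allVecs d))
      ≡⟨ cong sumℚ (Listₚ.map-cong weighted (allVecs d)) ⟩
    sumℚ (map (λ c → dyadic (hits (s ⊕ lincomb B c) (vectors W) x) (d + size W)) (allVecs d))
      ≡⟨ sumℚ-dyadic (d + size W) _ (allVecs d) ⟩
    dyadic (sum (map (λ c → hits (s ⊕ lincomb B c) (vectors W) x) (allVecs d))) (d + size W)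
      ≡⟨ cong₂ dyadic (trans (sum-allVecs d _) (hits-cosets x)) (+-comm d (size W)) ⟩
    dyadic (2 ^ size W ℕ.* hits s B x) (size W + d)
      ≡⟨ dyadic-cancel (hits s B x) d (size W) ⟩
    dyadic (hits s B x) d
      ≡⟨ pmf≡dyadic-hits X x ⟨
    pmf X x ∎)
    where
    weighted : ∀ c → dyadic 1 d * pmf (coset (s ⊕ lincomb B c) W) x
                   ≡ dyadic (hits (s ⊕ lincomb B c) (vectors W) x) (d + size W)
    weighted c = begin
      dyadic 1 d * pmf (coset (s ⊕ lincomb B c) W) x
        ≡⟨ cong (dyadic 1 d *_) (pmf≡dyadic-hits (coset (s ⊕ lincomb B c) W) x) ⟩
      dyadic 1 d * dyadic h (size W)    ≡⟨ dyadic-* 1 h d (size W) ⟩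
      dyadic (1 ℕ.* h) (d + size W)     ≡⟨ cong (λ a → dyadic a (d + size W)) (*-identityˡ h) ⟩
      dyadic h (d + size W)             ∎
      where h = hits (s ⊕ lincomb B c) (vectors W) x

uniform-weights : ∀ d → sumℚ (map (λ _ → dyadic 1 d) (allVecs d)) ≡ 1ℚ
uniform-weights d = begin
  sumℚ (map (λ _ → dyadic 1 d) (allVecs d))      ≡⟨ sumℚ-dyadic d (λ _ → 1) (allVecs d) ⟩
  dyadic (sum (map (λ _ → 1) (allVecs d))) d
    ≡⟨ cong₂ dyadic (trans (sum-allVecs d _) (∑-const d 1)) (sym (+-identityʳ d)) ⟩
  dyadic (2 ^ d ℕ.* 1) (d + 0)                   ≡⟨ dyadic-cancel 1 0 d ⟩
  1ℚ                                             ∎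

map-lookup-allFin : ∀ {A B : Set} (f : A → B) (xs : List A) → map (f ∘ lookup xs) (allFin (length xs)) ≡ map f xs
map-lookup-allFin f xs = begin
  map (f ∘ lookup xs) (allFin (length xs)) ≡⟨ Listₚ.map-tabulate (λ j → j) (f ∘ lookup xs) ⟩
  List.tabulate (f ∘ lookup xs)            ≡⟨ Listₚ.map-tabulate (lookup xs) f ⟨
  map f (List.tabulate (lookup xs))        ≡⟨ cong (map f) (Listₚ.tabulate-lookup xs) ⟩
  map f xs                                 ∎

lemma3p10 : ∀ (ns : List ℕ) (r : ℕ) (X : AffineSource (sum ns))
    → entropy X + r ≡ sum ns
    → Σ[ m ∈ ℕ ] Σ[ w ∈ (Fin m → ℚ) ] Σ[ Xs ∈ (Fin m → AffineSource (sum ns)) ]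
    ((∀ j → 0ℚ ≤ w j)
    × sumℚ (map w (allFin m)) ≡ 1ℚ
    × (∀ x → pmf X x ≡ sumℚ (map (λ j → w j * pmf (Xs j) x) (allFin m)))
    × (∀ j → Σ[ Ys ∈ All AffineSource ns ]
    (EntropyBounds r ns Ys × (∀ x → pmf (Xs j) x ≡ prodPmf ns Ys x))))
lemma3p10 ns r X dim+r≡n =
  length (allVecs d) , (λ _ → dyadic 1 d) , component ∘ lookup (allVecs d) ,
  (λ _ → dyadic-nonNeg 1 d) ,
  trans (cong sumℚ (map-lookup-allFin (λ _ → dyadic 1 d) (allVecs d))) (uniform-weights d) ,
  (λ x → trans (pmf-average-cosets X W blockDiag-⊆ x)
               (cong sumℚ (sym (map-lookup-allFin (λ c → dyadic 1 d * pmf (component c) x) (allVecs d))))) ,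
  λ j → let y = shift X ⊕ lincomb (basis X) (lookup (allVecs d) j) in
        blockCosets ns y blocks , blocks-large y , pmf-blockDiag ns y blocks
  where
  d = dim X
  open BlockDecomposition (blockDecompose ns r (basis X) (indep X) (≤-reflexive (sym dim+r≡n)))
  W = blockDiag blocks
  -- Indexing by all of F₂^d lists each coset of W 2^(size W) times, which keeps the weights uniform.
  component : BitVec d → AffineSource (sum ns)
  component c = coset (shift X ⊕ lincomb (basis X) c) W
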